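{- If $\Delta$ is a pure strongly shellable simplicial complex, then its codimension one graph $\Gamma(\Delta)$ is connected, $\operatorname{g}(\Gamma(\Delta))\le 4$, and $\operatorname{diam}(\Gamma(\Delta))\le\dim(\Delta)+1$.
   Context: A simplicial complex is a finite family of subsets of a vertex set closed under taking subsets; $\mathcal{F}(\Delta)$ is its set of facets, $\dim(A)=|A|-1$, $\dim\Delta$ is the maximum dimension of a face; $\Delta$ is pure if all facets have the same dimension. A linear order $F_1,\dots,F_t$ of $\mathcal{F}(\Delta)$ is a strong shelling order if for every $1\le i<j\le t$ there exists $k$ with $1\le k<j$ such that $|F_j\setminus F_k|=1$, $F_j\setminus F_k\subseteq F_j\setminus F_i$, and $F_k\setminus F_j\subseteq F_i$; $\Delta$ is strongly shellable if such an order exists. The codimension one graph $\Gamma(\Delta)$ is the simple graph with vertex set $\mathcal{F}(\Delta)$ in which $F,G$ are adjacent iff $|F\setminus G|=1$ (for pure $\Delta$). The girth $\operatorname{g}$ of a graph is the length of a shortest cycle, taken to be $0$ if the graph has no cycle; $\operatorname{diam}$ is the diameter. -}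

module Defs where

open import Data.Nat using (ℕ; zero; suc; _≤_; _<_)
open import Data.Fin using (Fin; toℕ; inject₁; fromℕ) renaming (zero to fzero; suc to fsuc)
open import Data.Fin.Subset using (Subset; _⊆_; _─_; ∣_∣)
open import Data.List using (List)
open import Data.List.Membership.Propositional using (_∈_)
open import Data.Product using (Σ; ∃; ∃-syntax; _×_; _,_)
open import Data.Sum using (_⊎_)
open import Relation.Nullary using (¬_)
open import Relation.Binary.PropositionalEquality using (_≡_)
open import Function.Definitions using (Injective)

record SimplicialComplex (n : ℕ) : Set where
  field
    faces    : List (Subset n)
    downward : ∀ {F G} → F ∈ faces → G ⊆ F → G ∈ faces
open SimplicialComplex public

module _ {n : ℕ} (Δ : SimplicialComplex n) where

  IsFace : Subset n → Set
  IsFace F = F ∈ faces Δ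

  IsFacet : Subset n → Set
  IsFacet F = IsFace F × (∀ G → IsFace G → F ⊆ G → F ≡ G)

  IsDimPlusOne : ℕ → Set
  IsDimPlusOne m = (∃[ F ] (IsFace F × ∣ F ∣ ≡ m)) × (∀ F → IsFace F → ∣ F ∣ ≤ m)

  Pure : Set
  Pure = ∀ F G → IsFacet F → IsFacet G → ∣ F ∣ ≡ ∣ G ∣

  IsStrongShellingOrder : (t : ℕ) → (Fin t → Subset n) → Set
  IsStrongShellingOrder t σ =
      Injective _≡_ _≡_ σ
    × (∀ i → IsFacet (σ i))
    × (∀ F → IsFacet F → ∃[ i ] σ i ≡ F)
    × (∀ (i j : Fin t) → toℕ i < toℕ j →
         ∃[ k ] (toℕ k < toℕ j
                × ∣ σ j ─ σ k ∣ ≡ 1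
                × (σ j ─ σ k) ⊆ (σ j ─ σ i)
                × (σ k ─ σ j) ⊆ σ i))

  StronglyShellable : Set
  StronglyShellable = ∃[ t ] Σ (Fin t → Subset n) λ σ → IsStrongShellingOrder t σ

  -- codimension one graph Γ(Δ): vertices = facets, F ~ G iff |F \ G| = 1
  Adj : Subset n → Subset n → Set
  Adj F G = ∣ F ─ G ∣ ≡ 1

  WalkOfLength : ℕ → Subset n → Subset n → Set
  WalkOfLength d F G =
    Σ (Fin (suc d) → Subset n) λ w → ( (∀ (i : Fin (suc d)) → IsFacet (w i))
           × w fzero ≡ F × w (fromℕ d) ≡ G
           × (∀ (i : Fin d) → Adj (w (inject₁ i)) (w (fsuc i))))

  Connected : Set
  Connected = ∀ F G → IsFacet F → IsFacet G → ∃[ d ] WalkOfLength d F G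

  CycleOfLength : ℕ → Set
  CycleOfLength zero = Data.Empty.⊥
    where import Data.Empty
  CycleOfLength (suc m) =
    2 ≤ m × Σ (Fin (suc m) → Subset n) λ c → ( Injective _≡_ _≡_ c
                   × (∀ (i : Fin (suc m)) → IsFacet (c i))
                   × (∀ (i : Fin m) → Adj (c (inject₁ i)) (c (fsuc i)))
                   × Adj (c (fromℕ m)) (c fzero))

  -- g is the girth of Γ(Δ) (0 if Γ(Δ) has no cycle)
  IsGirth : ℕ → Set
  IsGirth g =
      (g ≡ 0 × (∀ k → ¬ CycleOfLength k))
    ⊎ (CycleOfLength g × (∀ k → CycleOfLength k → g ≤ k))

  DiamAtMost : ℕ → Set
  DiamAtMost D = ∀ F G → IsFacet F → IsFacet G → ∃[ d ] (d ≤ D × WalkOfLength d F G)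

-- For i < j the strong shelling condition provides k < j with F_k adjacent to
-- F_j and one step closer to F_i, i.e. |F_k ∖ F_i| = |F_j ∖ F_i| - 1.  By
-- induction on |F_j ∖ F_i| this gives a walk of that length from F_i to F_j,
-- and |F_j ∖ F_i| ≤ |F_j| = dim Δ + 1.  For the girth, the facet F_j with the
-- largest shelling index on a cycle has two distinct neighbours F_a, F_b on it
-- with a < b < j.  Either F_a and F_b are adjacent, giving a triangle, or the
-- shelling condition for (a, b) gives k < b with F_k adjacent to F_b; then
-- |F_k ∖ F_a| = |F_b ∖ F_a| - 1 ≤ 2 - 1, so F_j F_a F_k F_b is a square.
module Submission where

open import Defs
open import Data.Nat using (ℕ; zero; suc; _+_; _≤_; _<_; z≤n; s≤s; s≤s⁻¹; _≟_)
open import Data.Nat.Properties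
  using (+-suc; +-cancelˡ-≡; suc-injective; ≤-refl; ≤-trans; <⇒≤; ≰⇒>; _≤?_;
         ≤-antisym; <-trans; <-irrefl; ≤∧≢⇒<; n≢0⇒n>0; m≢1+n+m;
         m≤n⇒m≤1+n; n≤1+n; +-monoʳ-≤)
open import Data.Fin using (Fin; toℕ; inject₁; fromℕ) renaming (zero to fzero; suc to fsuc)
import Data.Fin.Properties as Finₚ
open import Data.Fin.Relation.Unary.Top using (view; ‵fromℕ; ‵inject₁)
open import Data.Fin.Subset using (Subset; _⊆_; _─_; _-_; ∣_∣; inside; outside)
open import Data.Fin.Subset.Properties
  using (drop-∷-⊆; ⊆-antisym; _∈?_; x∈p∧x∉q⇒x∈p─q; x∈p⇒∣p-x∣<∣p∣; ∣p─q∣≤∣p∣)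
open import Data.Vec using (Vec; []; _∷_; lookup; here)
open import Data.Vec.Properties using (≡-dec)
open import Data.Vec.Relation.Unary.Unique.Propositional using (Unique)
open import Data.Vec.Relation.Unary.AllPairs using ([]; _∷_)
open import Data.Vec.Relation.Unary.All using ([]; _∷_)
open import Data.Vec.Relation.Unary.Unique.Propositional.Properties using (lookup-injective)
import Data.Bool.Properties as Boolₚ
open import Data.Product using (∃-syntax; _×_; _,_; proj₁; proj₂)
open import Data.Sum using (_⊎_; inj₁; inj₂; [_,_]′)
open import Relation.Nullary using (Dec; yes; no; contradiction)
open import Relation.Nullary.Decidable using (_×-dec_; ¬?)
open import Relation.Binary.Definitions using (tri<; tri≈; tri>)
open import Relation.Binary.PropositionalEquality
  using (_≡_; _≢_; refl; sym; trans; cong; subst; subst₂; module ≡-Reasoning)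
open import Function using (_∘_)

private
  variable
    n : ℕ

∣p∣+∣q─p∣≡∣q∣+∣p─q∣ : ∀ (p q : Subset n) → ∣ p ∣ + ∣ q ─ p ∣ ≡ ∣ q ∣ + ∣ p ─ q ∣
∣p∣+∣q─p∣≡∣q∣+∣p─q∣ []            []            = refl
∣p∣+∣q─p∣≡∣q∣+∣p─q∣ (inside  ∷ p) (inside  ∷ q) = cong suc (∣p∣+∣q─p∣≡∣q∣+∣p─q∣ p q)
∣p∣+∣q─p∣≡∣q∣+∣p─q∣ (inside  ∷ p) (outside ∷ q) =
  trans (cong suc (∣p∣+∣q─p∣≡∣q∣+∣p─q∣ p q)) (sym (+-suc _ _))
∣p∣+∣q─p∣≡∣q∣+∣p─q∣ (outside ∷ p) (inside  ∷ q) =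
  trans (+-suc _ _) (cong suc (∣p∣+∣q─p∣≡∣q∣+∣p─q∣ p q))
∣p∣+∣q─p∣≡∣q∣+∣p─q∣ (outside ∷ p) (outside ∷ q) = ∣p∣+∣q─p∣≡∣q∣+∣p─q∣ p q

∣p∣≡∣q∣⇒∣p─q∣≡∣q─p∣ : ∀ (p q : Subset n) → ∣ p ∣ ≡ ∣ q ∣ → ∣ p ─ q ∣ ≡ ∣ q ─ p ∣
∣p∣≡∣q∣⇒∣p─q∣≡∣q─p∣ p q ∣p∣≡∣q∣ = sym (+-cancelˡ-≡ ∣ p ∣ _ _ (begin
  ∣ p ∣ + ∣ q ─ p ∣  ≡⟨ ∣p∣+∣q─p∣≡∣q∣+∣p─q∣ p q ⟩
  ∣ q ∣ + ∣ p ─ q ∣  ≡⟨ cong (_+ ∣ p ─ q ∣) (sym ∣p∣≡∣q∣) ⟩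
  ∣ p ∣ + ∣ p ─ q ∣  ∎))
  where open ≡-Reasoning

∣p─p∣≡0 : ∀ (p : Subset n) → ∣ p ─ p ∣ ≡ 0
∣p─p∣≡0 []            = refl
∣p─p∣≡0 (inside  ∷ p) = ∣p─p∣≡0 p
∣p─p∣≡0 (outside ∷ p) = ∣p─p∣≡0 p

∣p─q∣≡0⇒p⊆q : ∀ (p q : Subset n) → ∣ p ─ q ∣ ≡ 0 → p ⊆ q
∣p─q∣≡0⇒p⊆q p q ∣p─q∣≡0 {x} x∈p with x ∈? q
... | yes x∈q = x∈q
... | no  x∉q = contradiction
  (subst (∣ p ─ q - x ∣ <_) ∣p─q∣≡0 (x∈p⇒∣p-x∣<∣p∣ (x∈p∧x∉q⇒x∈p─q x∈p x∉q))) λ ()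

∣p∣≡∣q∣∧∣p─q∣≡0⇒p≡q : ∀ (p q : Subset n) → ∣ p ∣ ≡ ∣ q ∣ → ∣ p ─ q ∣ ≡ 0 → p ≡ q
∣p∣≡∣q∣∧∣p─q∣≡0⇒p≡q p q ∣p∣≡∣q∣ ∣p─q∣≡0 = ⊆-antisym
  (∣p─q∣≡0⇒p⊆q p q ∣p─q∣≡0)
  (∣p─q∣≡0⇒p⊆q q p (trans (sym (∣p∣≡∣q∣⇒∣p─q∣≡∣q─p∣ p q ∣p∣≡∣q∣)) ∣p─q∣≡0))

∣p─r∣≤∣p─q∣+∣q─r∣ : ∀ (p q r : Subset n) → ∣ p ─ r ∣ ≤ ∣ p ─ q ∣ + ∣ q ─ r ∣
∣p─r∣≤∣p─q∣+∣q─r∣ []            []            []            = z≤n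
∣p─r∣≤∣p─q∣+∣q─r∣ (inside  ∷ p) (inside  ∷ q) (inside  ∷ r) = ∣p─r∣≤∣p─q∣+∣q─r∣ p q r
∣p─r∣≤∣p─q∣+∣q─r∣ (inside  ∷ p) (inside  ∷ q) (outside ∷ r) =
  subst (suc ∣ p ─ r ∣ ≤_) (sym (+-suc ∣ p ─ q ∣ ∣ q ─ r ∣)) (s≤s (∣p─r∣≤∣p─q∣+∣q─r∣ p q r))
∣p─r∣≤∣p─q∣+∣q─r∣ (inside  ∷ p) (outside ∷ q) (inside  ∷ r) =
  m≤n⇒m≤1+n (∣p─r∣≤∣p─q∣+∣q─r∣ p q r)
∣p─r∣≤∣p─q∣+∣q─r∣ (inside  ∷ p) (outside ∷ q) (outside ∷ r) = s≤s (∣p─r∣≤∣p─q∣+∣q─r∣ p q r)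
∣p─r∣≤∣p─q∣+∣q─r∣ (outside ∷ p) (inside  ∷ q) (inside  ∷ r) = ∣p─r∣≤∣p─q∣+∣q─r∣ p q r
∣p─r∣≤∣p─q∣+∣q─r∣ (outside ∷ p) (inside  ∷ q) (outside ∷ r) =
  ≤-trans (∣p─r∣≤∣p─q∣+∣q─r∣ p q r) (+-monoʳ-≤ ∣ p ─ q ∣ (n≤1+n _))
∣p─r∣≤∣p─q∣+∣q─r∣ (outside ∷ p) (outside ∷ q) (inside  ∷ r) = ∣p─r∣≤∣p─q∣+∣q─r∣ p q r
∣p─r∣≤∣p─q∣+∣q─r∣ (outside ∷ p) (outside ∷ q) (outside ∷ r) = ∣p─r∣≤∣p─q∣+∣q─r∣ p q r

∣q─r∣+∣r─p∣≡∣q─p∣ : ∀ (p q r : Subset n) → q ─ r ⊆ q ─ p → r ─ q ⊆ p →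
                    ∣ q ─ r ∣ + ∣ r ─ p ∣ ≡ ∣ q ─ p ∣
∣q─r∣+∣r─p∣≡∣q─p∣ []            []            []            _  _  = refl
∣q─r∣+∣r─p∣≡∣q─p∣ (inside  ∷ p) (inside  ∷ q) (inside  ∷ r) h₁ h₂ =
  ∣q─r∣+∣r─p∣≡∣q─p∣ p q r (drop-∷-⊆ h₁) (drop-∷-⊆ h₂)
∣q─r∣+∣r─p∣≡∣q─p∣ (outside ∷ p) (inside  ∷ q) (inside  ∷ r) h₁ h₂ =
  trans (+-suc _ _) (cong suc (∣q─r∣+∣r─p∣≡∣q─p∣ p q r (drop-∷-⊆ h₁) (drop-∷-⊆ h₂)))
∣q─r∣+∣r─p∣≡∣q─p∣ (inside  ∷ p) (inside  ∷ q) (outside ∷ r) h₁ h₂ = contradiction (h₁ here) λ ()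
∣q─r∣+∣r─p∣≡∣q─p∣ (outside ∷ p) (inside  ∷ q) (outside ∷ r) h₁ h₂ =
  cong suc (∣q─r∣+∣r─p∣≡∣q─p∣ p q r (drop-∷-⊆ h₁) (drop-∷-⊆ h₂))
∣q─r∣+∣r─p∣≡∣q─p∣ (inside  ∷ p) (outside ∷ q) (inside  ∷ r) h₁ h₂ =
  ∣q─r∣+∣r─p∣≡∣q─p∣ p q r (drop-∷-⊆ h₁) (drop-∷-⊆ h₂)
∣q─r∣+∣r─p∣≡∣q─p∣ (outside ∷ p) (outside ∷ q) (inside  ∷ r) h₁ h₂ = contradiction (h₂ here) λ ()
∣q─r∣+∣r─p∣≡∣q─p∣ (inside  ∷ p) (outside ∷ q) (outside ∷ r) h₁ h₂ =
  ∣q─r∣+∣r─p∣≡∣q─p∣ p q r (drop-∷-⊆ h₁) (drop-∷-⊆ h₂)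
∣q─r∣+∣r─p∣≡∣q─p∣ (outside ∷ p) (outside ∷ q) (outside ∷ r) h₁ h₂ =
  ∣q─r∣+∣r─p∣≡∣q─p∣ p q r (drop-∷-⊆ h₁) (drop-∷-⊆ h₂)

∃-argmax : ∀ m (f : Fin (suc m) → ℕ) → ∃[ p ] (∀ q → f q ≤ f p)
∃-argmax zero    f = fzero , λ { fzero → ≤-refl }
∃-argmax (suc m) f with ∃-argmax m (f ∘ fsuc)
... | p , f∘fsuc≤fp with f fzero ≤? f (fsuc p)
...   | yes f0≤ = fsuc p , λ { fzero → f0≤ ; (fsuc q) → f∘fsuc≤fp q }
...   | no  f0≰ = fzero , λ { fzero → ≤-refl ; (fsuc q) → ≤-trans (f∘fsuc≤fp q) (<⇒≤ (≰⇒> f0≰)) }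

module CodimensionOneGraph (Δ : SimplicialComplex n) (pure : Pure Δ) where

  Adj-sym : ∀ {F G} → IsFacet Δ F → IsFacet Δ G → Adj Δ F G → Adj Δ G F
  Adj-sym {F} {G} F-facet G-facet = trans (∣p∣≡∣q∣⇒∣p─q∣≡∣q─p∣ G F (pure G F G-facet F-facet))

  Adj-irrefl : ∀ {F G} → Adj Δ F G → F ≢ G
  Adj-irrefl {F} F~F refl = contradiction (trans (sym F~F) (∣p─p∣≡0 F)) λ ()

  adj? : ∀ F G → Dec (Adj Δ F G)
  adj? F G = ∣ F ─ G ∣ ≟ 1

  infixr 5 _∷⟨_⟩_

  data Walk : ℕ → Subset n → Subset n → Set where
    [_]    : ∀ {F} → IsFacet Δ F → Walk 0 F F
    _∷⟨_⟩_ : ∀ {d F G H} → IsFacet Δ F → Adj Δ F G → Walk d G H → Walk (suc d) F H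

  head-facet : ∀ {d F G} → Walk d F G → IsFacet Δ F
  head-facet [ F-facet ]         = F-facet
  head-facet (F-facet ∷⟨ _ ⟩ _) = F-facet

  extend : ∀ {d F G H} → Walk d F G → Adj Δ G H → IsFacet Δ H → Walk (suc d) F H
  extend [ G-facet ]            G~H H-facet = G-facet ∷⟨ G~H ⟩ [ H-facet ]
  extend (F-facet ∷⟨ F~F′ ⟩ w) G~H H-facet = F-facet ∷⟨ F~F′ ⟩ extend w G~H H-facet

  reverse : ∀ {d F G} → Walk d F G → Walk d G F
  reverse [ F-facet ]          = [ F-facet ]
  reverse (F-facet ∷⟨ F~G ⟩ w) = extend (reverse w) (Adj-sym F-facet (head-facet w) F~G) F-facet

  vertex : ∀ {d F G} → Walk d F G → Fin (suc d) → Subset n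
  vertex {F = F} [ _ ]         _        = F
  vertex {F = F} (_ ∷⟨ _ ⟩ _) fzero    = F
  vertex         (_ ∷⟨ _ ⟩ w) (fsuc i) = vertex w i

  vertex-first : ∀ {d F G} (w : Walk d F G) → vertex w fzero ≡ F
  vertex-first [ _ ]        = refl
  vertex-first (_ ∷⟨ _ ⟩ _) = refl

  vertex-last : ∀ {d F G} (w : Walk d F G) → vertex w (fromℕ d) ≡ G
  vertex-last [ _ ]        = refl
  vertex-last (_ ∷⟨ _ ⟩ w) = vertex-last w

  vertex-facet : ∀ {d F G} (w : Walk d F G) i → IsFacet Δ (vertex w i)
  vertex-facet [ F-facet ]         _        = F-facet
  vertex-facet (F-facet ∷⟨ _ ⟩ _) fzero    = F-facet
  vertex-facet (_ ∷⟨ _ ⟩ w)       (fsuc i) = vertex-facet w i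

  vertex-adj : ∀ {d F G} (w : Walk d F G) (i : Fin d) →
               Adj Δ (vertex w (inject₁ i)) (vertex w (fsuc i))
  vertex-adj {F = F} (_ ∷⟨ F~G ⟩ w) fzero    = subst (Adj Δ F) (sym (vertex-first w)) F~G
  vertex-adj         (_ ∷⟨ _ ⟩ w)   (fsuc i) = vertex-adj w i

  toWalkOfLength : ∀ {d F G} → Walk d F G → WalkOfLength Δ d F G
  toWalkOfLength w = vertex w , vertex-facet w , vertex-first w , vertex-last w , vertex-adj w

  Triangle : Subset n → Subset n → Subset n → Set
  Triangle F A B = Adj Δ F A × Adj Δ A B × Adj Δ B F

  Square : Subset n → Subset n → Subset n → Subset n → Set
  Square F A C B = Adj Δ F A × Adj Δ A C × Adj Δ C B × Adj Δ B F × F ≢ C × A ≢ B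

  triangle? : ∀ F A B → Dec (Triangle F A B)
  triangle? F A B = adj? F A ×-dec adj? A B ×-dec adj? B F

  square? : ∀ F A C B → Dec (Square F A C B)
  square? F A C B = adj? F A ×-dec adj? A C ×-dec adj? C B ×-dec adj? B F
    ×-dec ¬? (≡-dec Boolₚ._≟_ F C) ×-dec ¬? (≡-dec Boolₚ._≟_ A B)

  triangle⇒cycle : ∀ {F A B} → IsFacet Δ F → IsFacet Δ A → IsFacet Δ B →
                   Triangle F A B → CycleOfLength Δ 3
  triangle⇒cycle {F} {A} {B} F-facet A-facet B-facet (F~A , A~B , B~F) =
    s≤s (s≤s z≤n) , lookup vs , lookup-injective vs-unique _ _ , facet , adj , B~F
    where
    vs : Vec (Subset n) 3
    vs = F ∷ A ∷ B ∷ []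
    vs-unique : Unique vs
    vs-unique = (Adj-irrefl F~A ∷ Adj-irrefl B~F ∘ sym ∷ []) ∷ (Adj-irrefl A~B ∷ []) ∷ [] ∷ []
    facet : ∀ i → IsFacet Δ (lookup vs i)
    facet fzero               = F-facet
    facet (fsuc fzero)        = A-facet
    facet (fsuc (fsuc fzero)) = B-facet
    adj : ∀ (i : Fin 2) → Adj Δ (lookup vs (inject₁ i)) (lookup vs (fsuc i))
    adj fzero        = F~A
    adj (fsuc fzero) = A~B

  square⇒cycle : ∀ {F A C B} → IsFacet Δ F → IsFacet Δ A → IsFacet Δ C → IsFacet Δ B →
                 Square F A C B → CycleOfLength Δ 4
  square⇒cycle {F} {A} {C} {B} F-facet A-facet C-facet B-facet
               (F~A , A~C , C~B , B~F , F≢C , A≢B) =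
    s≤s (s≤s z≤n) , lookup vs , lookup-injective vs-unique _ _ , facet , adj , B~F
    where
    vs : Vec (Subset n) 4
    vs = F ∷ A ∷ C ∷ B ∷ []
    vs-unique : Unique vs
    vs-unique = (Adj-irrefl F~A ∷ F≢C ∷ Adj-irrefl B~F ∘ sym ∷ [])
              ∷ (Adj-irrefl A~C ∷ A≢B ∷ []) ∷ (Adj-irrefl C~B ∷ []) ∷ [] ∷ []
    facet : ∀ i → IsFacet Δ (lookup vs i)
    facet fzero                      = F-facet
    facet (fsuc fzero)               = A-facet
    facet (fsuc (fsuc fzero))        = C-facet
    facet (fsuc (fsuc (fsuc fzero))) = B-facet
    adj : ∀ (i : Fin 3) → Adj Δ (lookup vs (inject₁ i)) (lookup vs (fsuc i))
    adj fzero               = F~A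
    adj (fsuc fzero)        = A~C
    adj (fsuc (fsuc fzero)) = C~B

  length≥3 : ∀ k → CycleOfLength Δ k → 3 ≤ k
  length≥3 (suc m) (2≤m , _) = s≤s 2≤m

  cycle-neighbours : ∀ {m} (c : Fin (3 + m) → Subset n) → (∀ i → IsFacet Δ (c i)) →
    (∀ (i : Fin (2 + m)) → Adj Δ (c (inject₁ i)) (c (fsuc i))) →
    Adj Δ (c (fromℕ (2 + m))) (c fzero) →
    ∀ p → ∃[ q ] ∃[ q′ ] (q ≢ q′ × Adj Δ (c p) (c q) × Adj Δ (c p) (c q′))
  cycle-neighbours c c-facet c-adj c-closed fzero =
    fsuc fzero , fromℕ _ , (λ ()) , c-adj fzero , Adj-sym (c-facet _) (c-facet fzero) c-closed
  cycle-neighbours c c-facet c-adj c-closed (fsuc i) with view i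
  ... | ‵fromℕ     = inject₁ i , fzero , (λ ()) ,
                     Adj-sym (c-facet _) (c-facet _) (c-adj i) , c-closed
  ... | ‵inject₁ j = inject₁ (inject₁ j) , fsuc (fsuc j) , before≢after ,
                     Adj-sym (c-facet _) (c-facet _) (c-adj (inject₁ j)) , c-adj (fsuc j)
    where
    before≢after : inject₁ (inject₁ j) ≢ fsuc (fsuc j)
    before≢after e = m≢1+n+m (toℕ j)
      (trans (sym (trans (Finₚ.toℕ-inject₁ (inject₁ j)) (Finₚ.toℕ-inject₁ j))) (cong toℕ e))

module StrongShelling (Δ : SimplicialComplex n) (pure : Pure Δ)
                      {t : ℕ} (σ : Fin t → Subset n) (shelling : IsStrongShellingOrder Δ t σ) where

  open CodimensionOneGraph Δ pure

  σ-injective : ∀ {i j} → σ i ≡ σ j → i ≡ j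
  σ-injective = proj₁ shelling

  σ-facet : ∀ i → IsFacet Δ (σ i)
  σ-facet = proj₁ (proj₂ shelling)

  σ-surjective : ∀ F → IsFacet Δ F → ∃[ i ] σ i ≡ F
  σ-surjective = proj₁ (proj₂ (proj₂ shelling))

  ∣σi─σj∣≡∣σj─σi∣ : ∀ i j → ∣ σ i ─ σ j ∣ ≡ ∣ σ j ─ σ i ∣
  ∣σi─σj∣≡∣σj─σi∣ i j = ∣p∣≡∣q∣⇒∣p─q∣≡∣q─p∣ (σ i) (σ j) (pure _ _ (σ-facet i) (σ-facet j))

  shelling-step : ∀ {i j} → toℕ i < toℕ j →
    ∃[ k ] (toℕ k < toℕ j × Adj Δ (σ j) (σ k) × suc ∣ σ k ─ σ i ∣ ≡ ∣ σ j ─ σ i ∣)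
  shelling-step {i} {j} i<j with proj₂ (proj₂ (proj₂ shelling)) i j i<j
  ... | k , k<j , σj~σk , h₁ , h₂ =
    k , k<j , σj~σk , subst (λ d → d + ∣ σ k ─ σ i ∣ ≡ ∣ σ j ─ σ i ∣) σj~σk
                        (∣q─r∣+∣r─p∣≡∣q─p∣ (σ i) (σ j) (σ k) h₁ h₂)

  extendTowards : ∀ d → (∀ i j → ∣ σ j ─ σ i ∣ ≡ d → Walk d (σ i) (σ j)) →
                  ∀ {i j} → toℕ i < toℕ j → ∣ σ j ─ σ i ∣ ≡ suc d → Walk (suc d) (σ i) (σ j)
  extendTowards d walk {i} {j} i<j ∣σj─σi∣≡1+d with shelling-step i<j
  ... | k , _ , σj~σk , closer =
    extend (walk i k (suc-injective (trans closer ∣σj─σi∣≡1+d)))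
           (Adj-sym (σ-facet j) (σ-facet k) σj~σk) (σ-facet j)

  shellingWalk : ∀ d i j → ∣ σ j ─ σ i ∣ ≡ d → Walk d (σ i) (σ j)
  shellingWalk zero i j ∣σj─σi∣≡0 =
    subst (Walk 0 (σ i)) (∣p∣≡∣q∣∧∣p─q∣≡0⇒p≡q (σ i) (σ j) (pure _ _ (σ-facet i) (σ-facet j))
                           (trans (∣σi─σj∣≡∣σj─σi∣ i j) ∣σj─σi∣≡0))
      [ σ-facet i ]
  shellingWalk (suc d) i j ∣σj─σi∣≡1+d with Finₚ.<-cmp i j
  ... | tri< i<j _ _ = extendTowards d (shellingWalk d) i<j ∣σj─σi∣≡1+d
  ... | tri> _ _ j<i =
    reverse (extendTowards d (shellingWalk d) j<i (trans (∣σi─σj∣≡∣σj─σi∣ i j) ∣σj─σi∣≡1+d))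
  ... | tri≈ _ refl _ = contradiction (trans (sym ∣σj─σi∣≡1+d) (∣p─p∣≡0 (σ i))) λ ()

  connected : Connected Δ
  connected F G F-facet G-facet with σ-surjective F F-facet | σ-surjective G G-facet
  ... | i , refl | j , refl = _ , toWalkOfLength (shellingWalk _ i j refl)

  diameter≤dim+1 : ∀ m → IsDimPlusOne Δ m → DiamAtMost Δ m
  diameter≤dim+1 m (_ , ∣face∣≤m) F G F-facet G-facet
    with σ-surjective F F-facet | σ-surjective G G-facet
  ... | i , refl | j , refl =
    _ , ≤-trans (∣p─q∣≤∣p∣ (σ j) (σ i)) (∣face∣≤m (σ j) (proj₁ (σ-facet j))) ,
    toWalkOfLength (shellingWalk _ i j refl)

  HasTriangle : Set
  HasTriangle = ∃[ i ] ∃[ j ] ∃[ l ] Triangle (σ i) (σ j) (σ l)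

  HasSquare : Set
  HasSquare = ∃[ i ] ∃[ j ] ∃[ k ] ∃[ l ] Square (σ i) (σ j) (σ k) (σ l)

  hasTriangle? : Dec HasTriangle
  hasTriangle? = Finₚ.any? λ i → Finₚ.any? λ j → Finₚ.any? λ l → triangle? (σ i) (σ j) (σ l)

  hasSquare? : Dec HasSquare
  hasSquare? = Finₚ.any? λ i → Finₚ.any? λ j → Finₚ.any? λ k → Finₚ.any? λ l →
    square? (σ i) (σ j) (σ k) (σ l)

  hasTriangle⇒cycle : HasTriangle → CycleOfLength Δ 3
  hasTriangle⇒cycle (i , j , l , △) = triangle⇒cycle (σ-facet i) (σ-facet j) (σ-facet l) △

  hasSquare⇒cycle : HasSquare → CycleOfLength Δ 4
  hasSquare⇒cycle (i , j , k , l , □) =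
    square⇒cycle (σ-facet i) (σ-facet j) (σ-facet k) (σ-facet l) □

  index : ∀ {F} → IsFacet Δ F → Fin t
  index {F} F-facet = proj₁ (σ-surjective F F-facet)

  σ-index : ∀ {F} (F-facet : IsFacet Δ F) → σ (index F-facet) ≡ F
  σ-index {F} F-facet = proj₂ (σ-surjective F F-facet)

  Adj-index : ∀ {F G} (F-facet : IsFacet Δ F) (G-facet : IsFacet Δ G) →
              Adj Δ F G → Adj Δ (σ (index F-facet)) (σ (index G-facet))
  Adj-index F-facet G-facet = subst₂ (Adj Δ) (sym (σ-index F-facet)) (sym (σ-index G-facet))

  cycle⇒hasTriangle : CycleOfLength Δ 3 → HasTriangle
  cycle⇒hasTriangle (_ , c , _ , c-facet , c-adj , c-closed) =
    index (c-facet fzero) , index (c-facet (fsuc fzero)) , index (c-facet (fsuc (fsuc fzero))) ,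
    Adj-index _ _ (c-adj fzero) , Adj-index _ _ (c-adj (fsuc fzero)) , Adj-index _ _ c-closed

  earlierNeighbours⇒triangle⊎square : ∀ {j a b} → toℕ a < toℕ b → toℕ b < toℕ j → σ a ≢ σ b →
    Adj Δ (σ j) (σ a) → Adj Δ (σ j) (σ b) → HasTriangle ⊎ HasSquare
  earlierNeighbours⇒triangle⊎square {j} {a} {b} a<b b<j σa≢σb σj~σa σj~σb with adj? (σ a) (σ b)
  ... | yes σa~σb = inj₁ (j , a , b , σj~σa , σa~σb , Adj-sym (σ-facet j) (σ-facet b) σj~σb)
  ... | no  σa≁σb with shelling-step a<b
  ... | k , k<b , σb~σk , closer =
    inj₂ (j , a , k , b , σj~σa , Adj-sym (σ-facet k) (σ-facet a) σk~σa ,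
          Adj-sym (σ-facet b) (σ-facet k) σb~σk , Adj-sym (σ-facet j) (σ-facet b) σj~σb ,
          σj≢σk , σa≢σb)
    where
    σj≢σk : σ j ≢ σ k
    σj≢σk σj≡σk = <-irrefl (cong toℕ (sym (σ-injective σj≡σk))) (<-trans k<b b<j)
    ∣σb─σa∣≤2 : ∣ σ b ─ σ a ∣ ≤ 2
    ∣σb─σa∣≤2 = subst₂ (λ x y → ∣ σ b ─ σ a ∣ ≤ x + y)
      (trans (∣σi─σj∣≡∣σj─σi∣ b j) σj~σb) σj~σa (∣p─r∣≤∣p─q∣+∣q─r∣ (σ b) (σ j) (σ a))
    ∣σk─σa∣≢0 : ∣ σ k ─ σ a ∣ ≢ 0
    ∣σk─σa∣≢0 ∣σk─σa∣≡0 =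
      σa≁σb (trans (∣σi─σj∣≡∣σj─σi∣ a b) (trans (sym closer) (cong suc ∣σk─σa∣≡0)))
    σk~σa : Adj Δ (σ k) (σ a)
    σk~σa = ≤-antisym (s≤s⁻¹ (subst (_≤ 2) (sym closer) ∣σb─σa∣≤2)) (n≢0⇒n>0 ∣σk─σa∣≢0)

  twoEarlierNeighbours⇒triangle⊎square : ∀ {j a b} → toℕ a < toℕ j → toℕ b < toℕ j → σ a ≢ σ b →
    Adj Δ (σ j) (σ a) → Adj Δ (σ j) (σ b) → HasTriangle ⊎ HasSquare
  twoEarlierNeighbours⇒triangle⊎square {a = a} {b} a<j b<j σa≢σb σj~σa σj~σb with Finₚ.<-cmp a b
  ... | tri< a<b _ _ = earlierNeighbours⇒triangle⊎square a<b b<j σa≢σb σj~σa σj~σb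
  ... | tri> _ _ b<a = earlierNeighbours⇒triangle⊎square b<a a<j (σa≢σb ∘ sym) σj~σb σj~σa
  ... | tri≈ _ refl _ = contradiction refl σa≢σb

  cycle⇒triangle⊎square : ∀ k → CycleOfLength Δ k → HasTriangle ⊎ HasSquare
  cycle⇒triangle⊎square (suc (suc zero)) (s≤s () , _)
  cycle⇒triangle⊎square (suc (suc (suc m))) (_ , c , c-injective , c-facet , c-adj , c-closed)
    with ∃-argmax (2 + m) (λ p → toℕ (index (c-facet p)))
  ... | p , p-latest with cycle-neighbours c c-facet c-adj c-closed p
  ... | q , q′ , q≢q′ , cp~cq , cp~cq′ =
    twoEarlierNeighbours⇒triangle⊎square (earlier cp~cq) (earlier cp~cq′)
      (λ σ-same → q≢q′ (c-injective
        (trans (sym (σ-index (c-facet q))) (trans σ-same (σ-index (c-facet q′))))))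
      (Adj-index _ _ cp~cq) (Adj-index _ _ cp~cq′)
    where
    earlier : ∀ {q} → Adj Δ (c p) (c q) → toℕ (index (c-facet q)) < toℕ (index (c-facet p))
    earlier {q} cp~cq = ≤∧≢⇒< (p-latest q) (λ same-index → Adj-irrefl (Adj-index _ _ cp~cq)
      (cong σ (sym (Finₚ.toℕ-injective same-index))))

  girth≤4 : ∃[ g ] (IsGirth Δ g × g ≤ 4)
  girth≤4 with hasTriangle?
  ... | yes △ = 3 , inj₂ (hasTriangle⇒cycle △ , length≥3) , s≤s (s≤s (s≤s z≤n))
  ... | no ¬△ with hasSquare?
  ...   | yes □ = 4 , inj₂ (hasSquare⇒cycle □ , length≥4) , ≤-refl
    where
    length≥4 : ∀ k → CycleOfLength Δ k → 4 ≤ k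
    length≥4 k cycle = ≤∧≢⇒< (length≥3 k cycle)
      (λ 3≡k → ¬△ (cycle⇒hasTriangle (subst (CycleOfLength Δ) (sym 3≡k) cycle)))
  ...   | no ¬□ = 0 , inj₁ (refl , λ k cycle → [ ¬△ , ¬□ ]′ (cycle⇒triangle⊎square k cycle)) , z≤n

proposition4p9 : {n : ℕ} (Δ : SimplicialComplex n) → Pure Δ → StronglyShellable Δ →
    Connected Δ × (∃[ g ] (IsGirth Δ g × g ≤ 4)) × (∀ m → IsDimPlusOne Δ m → DiamAtMost Δ m)
proposition4p9 Δ pure (_ , σ , shelling) = connected , girth≤4 , diameter≤dim+1
  where open StrongShelling Δ pure σ shelling
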